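{- For every instance $I=\langle G,l,f,\omega\rangle$ and every set $R_1\subseteq V$, with $I'$ the derived instance defined in the context, $C^*_{conc\_bu}(I',R_1)\le C^*_{RFTFL}(I)+C_{UFL}(I,R_1)$.
   Context: $G=(V,E)$ is a graph with $V=\{1,\dots,n\}$ and positive edge lengths $l$; $d$ is the shortest-path distance; $d(v,R)=\min_{r\in R}d(v,r)$ (with $d(v,\emptyset)=+\infty$). Each node has opening cost $f(v)\ge0$ and demand $\omega(v)\ge0$. For $R\subseteq V$: $C_{facil}(I,R)=\sum_{r\in R}f(r)$, $C_{ship}(I,R)=\sum_{u\in V}\omega(u)d(u,R)$, $C_{UFL}(I,R)=C_{facil}(I,R)+C_{ship}(I,R)$, and $C_{RFTFL}(I,R)=C_{facil}(I,R)+\max_{r\in R}\sum_{v\in V}\omega(v)\,d(v,R\setminus\{r\})$; $C^*_{RFTFL}(I)$ is the minimum of $C_{RFTFL}(I,R)$ over nonempty $R\subseteq V$. For $R\subseteq V$ and $r\in R$, $\varphi(I,r,R)$ is the set of clients assigned to $r$, where each $u\in V$ is assigned to one facility $r\in R$ with $d(u,r)=d(u,R)$ (ties broken arbitrarily). The derived instance is $I'=\langle G,l,f',\omega'\rangle$ with $f'(r)=0$ for $r\in R_1$, $f'(v)=f(v)$ otherwise, and $\omega'(r)=\sum_{v\in\varphi(I,r,R_1)}\omega(v)$ for $r\in R_1$, $\omega'(v)=0$ for $v\notin R_1$. For an instance $J=\langle G,l,g,\mu\rangle$ and $R_2\subseteq V$: $C_{bu}(J,R_1,R_2)=\max_{r\in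 R_1}\mu(r)\,d(r,(R_1\cup R_2)\setminus\{r\})$, $C_{conc\_bu}(J,R_1,R_2)=\sum_{v\in R_2}g(v)+C_{bu}(J,R_1,R_2)$, and $C^*_{conc\_bu}(J,R_1)=\min_{R_2\subseteq V}C_{conc\_bu}(J,R_1,R_2)$.
   Formalization: The edge lengths l, opening costs f and demands ω take rational values, with +∞ as the length of a missing edge. -}

module Defs where

open import Data.Nat as ℕ using (ℕ; zero; suc)
open import Data.Bool using (Bool; true; false; if_then_else_)
open import Data.Fin using (Fin; zero; suc)
open import Data.Fin.Properties using () renaming (_≟_ to _≟F_)
open import Data.Fin.Subset using (Subset; _∈_; _∪_; _─_; ⁅_⁆; Nonempty)
open import Data.Vec using (Vec; []; _∷_; lookup; tabulate)
open import Data.List using (List; []; _∷_; _++_; map)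
open import Data.Rational using (ℚ; 0ℚ; _+_; _*_; _⊔_; _⊓_; _≤_; _<_)
open import Data.Rational.Properties using () renaming (_≟_ to _≟Q_)
open import Relation.Nullary using (yes; no; does)
open import Relation.Binary.PropositionalEquality using (_≡_)
open import Data.Product using (_×_; Σ)

data ℚ∞ : Set where
  fin : ℚ → ℚ∞
  ∞   : ℚ∞

infixl 6 _+∞_
_+∞_ : ℚ∞ → ℚ∞ → ℚ∞
fin p +∞ fin q = fin (p + q)
fin _ +∞ ∞     = ∞
∞     +∞ _     = ∞

_⊓∞_ : ℚ∞ → ℚ∞ → ℚ∞
fin p ⊓∞ fin q = fin (p ⊓ q)
fin p ⊓∞ ∞     = fin p
∞     ⊓∞ y     = y

_⊔∞_ : ℚ∞ → ℚ∞ → ℚ∞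
fin p ⊔∞ fin q = fin (p ⊔ q)
fin _ ⊔∞ ∞     = ∞
∞     ⊔∞ _     = ∞

-- scalar multiplication by a (non-negative) rational, with 0 · ∞ = 0
infixl 7 _·∞_
_·∞_ : ℚ → ℚ∞ → ℚ∞
q ·∞ fin p = fin (q * p)
q ·∞ ∞ with q ≟Q 0ℚ
... | yes _ = fin 0ℚ
... | no  _ = ∞

infix 4 _≤∞_
data _≤∞_ : ℚ∞ → ℚ∞ → Set where
  fin≤ : ∀ {p q} → p ≤ q → fin p ≤∞ fin q
  _≤∞∞ : ∀ x → x ≤∞ ∞

sumFin : ∀ {n} → (Fin n → ℚ∞) → ℚ∞
sumFin {zero}  g = fin 0ℚ
sumFin {suc n} g = g zero +∞ sumFin (λ i → g (suc i))

minFin : ∀ {n} → (Fin n → ℚ∞) → ℚ∞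
minFin {zero}  g = ∞
minFin {suc n} g = g zero ⊓∞ minFin (λ i → g (suc i))

-- maximum of non-negative values (empty maximum = 0)
maxFin : ∀ {n} → (Fin n → ℚ∞) → ℚ∞
maxFin {zero}  g = fin 0ℚ
maxFin {suc n} g = g zero ⊔∞ maxFin (λ i → g (suc i))

sumIn : ∀ {n} → Subset n → (Fin n → ℚ∞) → ℚ∞
sumIn R g = sumFin (λ r → if lookup R r then g r else fin 0ℚ)

minIn : ∀ {n} → Subset n → (Fin n → ℚ∞) → ℚ∞
minIn R g = minFin (λ r → if lookup R r then g r else ∞)

maxIn : ∀ {n} → Subset n → (Fin n → ℚ∞) → ℚ∞
maxIn R g = maxFin (λ r → if lookup R r then g r else fin 0ℚ)

allSubsets : ∀ n → List (Subset n)
allSubsets zero    = [] ∷ []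
allSubsets (suc n) = map (true ∷_) (allSubsets n) ++ map (false ∷_) (allSubsets n)

isEmpty : ∀ {n} → Subset n → Bool
isEmpty []          = true
isEmpty (true ∷ _)  = false
isEmpty (false ∷ R) = isEmpty R

minList : List ℚ∞ → ℚ∞
minList []       = ∞
minList (x ∷ xs) = x ⊓∞ minList xs

-- Graphs with edge lengths. l u v = fin x : edge {u,v} of length x;
-- l u v = ∞ : no edge.

Lengths : ℕ → Set
Lengths n = Fin n → Fin n → ℚ∞

ValidLengths : ∀ {n} → Lengths n → Set
ValidLengths {n} l =
  (∀ u v → l u v ≡ l v u) × (∀ u v x → l u v ≡ fin x → 0ℚ < x)

walkDist : ∀ {n} → Lengths n → ℕ → Fin n → Fin n → ℚ∞
walkDist l zero u v = if does (u ≟F v) then fin 0ℚ else ∞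
walkDist l (suc k) u v =
  walkDist l k u v ⊓∞ minFin (λ w → walkDist l k u w +∞ l w v)

-- shortest-path distance d (paths have at most n - 1 ≤ n edges)
dist : ∀ {n} → Lengths n → Fin n → Fin n → ℚ∞
dist {n} l = walkDist l n

distSet : ∀ {n} → Lengths n → Fin n → Subset n → ℚ∞
distSet l v R = minIn R (λ r → dist l v r)

Cfacil : ∀ {n} → (Fin n → ℚ) → Subset n → ℚ∞
Cfacil f R = sumIn R (λ r → fin (f r))

Cship : ∀ {n} → Lengths n → (Fin n → ℚ) → Subset n → ℚ∞
Cship l ω R = sumFin (λ u → ω u ·∞ distSet l u R)

CUFL : ∀ {n} → Lengths n → (Fin n → ℚ) → (Fin n → ℚ) → Subset n → ℚ∞
CUFL l f ω R = Cfacil f R +∞ Cship l ω R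

CRFTFL : ∀ {n} → Lengths n → (Fin n → ℚ) → (Fin n → ℚ) → Subset n → ℚ∞
CRFTFL l f ω R =
  Cfacil f R +∞ maxIn R (λ r → sumFin (λ v → ω v ·∞ distSet l v (R ─ ⁅ r ⁆)))

CRFTFL* : ∀ {n} → Lengths n → (Fin n → ℚ) → (Fin n → ℚ) → ℚ∞
CRFTFL* {n} l f ω =
  minList (map (λ R → if isEmpty R then ∞ else CRFTFL l f ω R) (allSubsets n))

-- assignment of clients to facilities of R (ties broken arbitrarily):
-- a u is a closest facility of R whenever R is non-empty.
-- φ(I, r, R) = { u | a u ≡ r }.
IsAssignment : ∀ {n} → Lengths n → Subset n → (Fin n → Fin n) → Set
IsAssignment {n} l R a =
  ∀ u → Nonempty R → (a u ∈ R) × (dist l u (a u) ≡ distSet l u R)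

f′ : ∀ {n} → (Fin n → ℚ) → Subset n → Fin n → ℚ
f′ f R₁ v = if lookup R₁ v then 0ℚ else f v

sumℚ : ∀ {n} → (Fin n → ℚ) → ℚ
sumℚ {zero}  g = 0ℚ
sumℚ {suc n} g = g zero + sumℚ (λ i → g (suc i))

ω′ : ∀ {n} → (Fin n → ℚ) → Subset n → (Fin n → Fin n) → Fin n → ℚ
ω′ ω R₁ a r =
  if lookup R₁ r then sumℚ (λ v → if does (a v ≟F r) then ω v else 0ℚ) else 0ℚ

Cbu : ∀ {n} → Lengths n → (Fin n → ℚ) → Subset n → Subset n → ℚ∞
Cbu l μ R₁ R₂ = maxIn R₁ (λ r → μ r ·∞ distSet l r ((R₁ ∪ R₂) ─ ⁅ r ⁆))

Cconcbu : ∀ {n} → Lengths n → (Fin n → ℚ) → (Fin n → ℚ) → Subset n → Subset n → ℚ∞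
Cconcbu l g μ R₁ R₂ = Cfacil g R₂ +∞ Cbu l μ R₁ R₂

Cconcbu* : ∀ {n} → Lengths n → (Fin n → ℚ) → (Fin n → ℚ) → Subset n → ℚ∞
Cconcbu* {n} l g μ R₁ = minList (map (Cconcbu l g μ R₁) (allSubsets n))

module Submission where

-- Fix any non-empty facility set R and use R itself as the backup
-- set R₂ of the concentrated instance I′.  Opening costs can only drop,
-- since f′ ≤ f.  A facility r ∈ R₁ carries the demand of the clients v
-- assigned to it, and each such v witnesses a route from r to the backup
-- set (R₁ ∪ R) ∖ {r}: go back to v (cost d(r,v) = d(v,R₁)) and then to
-- R ∖ {r}.  Summing over the clients of r bounds its backup cost by
-- C_ship(I,R₁) plus the failure cost of R when r fails; if r ∉ R the latter
-- is bounded by the failure cost of any r′ ∈ R.  Hence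
-- C_conc_bu(I′,R₁,R) ≤ C_RFTFL(I,R) + C_UFL(I,R₁), and minimising over R
-- gives the lemma.

open import Defs
open import Data.Nat as ℕ using (ℕ; zero; suc; z≤n; s≤s)
import Data.Nat.Properties as ℕ
open import Data.Rational using (ℚ; 0ℚ; _+_; _≤_; nonNegative)
import Data.Rational.Properties as ℚ
open import Data.Bool using (Bool; true; false; if_then_else_)
open import Data.Empty using (⊥-elim)
open import Data.Sum using (_⊎_; inj₁; inj₂)
open import Data.Product using (Σ; _×_; _,_; proj₁; proj₂)
open import Data.Fin using (Fin; zero; suc)
open import Data.Fin.Properties using (injective⇒≤) renaming (_≟_ to _≟F_)
open import Data.Fin.Subset using (Subset; _∈_; _∉_; _⊆_; _∪_; _─_; ⁅_⁆; Nonempty)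
open import Data.Fin.Subset.Properties using (_∈?_; x∈p∧x∉q⇒x∈p─q; p─q⊆p; q⊆p∪q; x∈⁅y⁆⇒x≡y)
open import Data.Vec using ([]; _∷_; lookup; here; there)
open import Data.Vec.Properties using ([]=⇒lookup; lookup⇒[]=)
open import Data.List as List using (List; []; _∷_)
open import Data.List.Relation.Unary.All as All using ([]; _∷_)
open import Data.List.Relation.Unary.All.Properties using (¬Any⇒All¬)
open import Data.List.Relation.Unary.Any using (here; there)
open import Data.List.Relation.Unary.Unique.Propositional using (Unique)
open import Data.List.Relation.Unary.AllPairs using ([]; _∷_)
open import Data.List.Membership.Propositional using () renaming (_∈_ to _∈ₗ_)
open import Data.List.Membership.Propositional.Properties
  using (∈-lookup; ∈-map⁺; ∈-++⁺ˡ; ∈-++⁺ʳ)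
import Data.List.Membership.DecPropositional as DecMembership
open import Function using (id; Injective)
open import Relation.Nullary using (yes; no; does)
open import Relation.Binary.Bundles using (Poset)
import Relation.Binary.Reasoning.PartialOrder
open import Relation.Binary.PropositionalEquality
  using (_≡_; refl; sym; trans; cong; cong₂; subst; isEquivalence; module ≡-Reasoning)

≤∞-refl : ∀ {x} → x ≤∞ x
≤∞-refl {fin p} = fin≤ ℚ.≤-refl
≤∞-refl {∞}     = ∞ ≤∞∞

≤∞-reflexive : ∀ {x y} → x ≡ y → x ≤∞ y
≤∞-reflexive refl = ≤∞-refl

≤∞-trans : ∀ {x y z} → x ≤∞ y → y ≤∞ z → x ≤∞ z
≤∞-trans (fin≤ p) (fin≤ q) = fin≤ (ℚ.≤-trans p q)
≤∞-trans {x} _ (_ ≤∞∞)      = x ≤∞∞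

≤∞-antisym : ∀ {x y} → x ≤∞ y → y ≤∞ x → x ≡ y
≤∞-antisym (fin≤ p) (fin≤ q) = cong fin (ℚ.≤-antisym p q)
≤∞-antisym (∞ ≤∞∞)  _        = refl

≤∞-poset : Poset _ _ _
≤∞-poset = record
  { _≤_ = _≤∞_
  ; isPartialOrder = record
    { isPreorder = record
      { isEquivalence = isEquivalence ; reflexive = ≤∞-reflexive ; trans = ≤∞-trans }
    ; antisym = ≤∞-antisym } }

module ≤∞-Reasoning = Relation.Binary.Reasoning.PartialOrder ≤∞-poset

+∞-mono : ∀ {a b c d} → a ≤∞ b → c ≤∞ d → a +∞ c ≤∞ b +∞ d
+∞-mono (fin≤ p) (fin≤ q) = fin≤ (ℚ.+-mono-≤ p q)
+∞-mono (fin≤ _) (_ ≤∞∞)  = _ ≤∞∞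
+∞-mono (_ ≤∞∞)  _        = _ ≤∞∞

+∞-comm : ∀ x y → x +∞ y ≡ y +∞ x
+∞-comm (fin p) (fin q) = cong fin (ℚ.+-comm p q)
+∞-comm (fin _) ∞       = refl
+∞-comm ∞       (fin _) = refl
+∞-comm ∞       ∞       = refl

+∞-assoc : ∀ x y z → (x +∞ y) +∞ z ≡ x +∞ (y +∞ z)
+∞-assoc (fin p) (fin q) (fin r) = cong fin (ℚ.+-assoc p q r)
+∞-assoc (fin _) (fin _) ∞       = refl
+∞-assoc (fin _) ∞       _       = refl
+∞-assoc ∞       _       _       = refl

+∞-identityˡ : ∀ x → fin 0ℚ +∞ x ≡ x
+∞-identityˡ (fin p) = cong fin (ℚ.+-identityˡ p)
+∞-identityˡ ∞       = refl

+∞-identityʳ : ∀ x → x +∞ fin 0ℚ ≡ x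
+∞-identityʳ x = trans (+∞-comm x _) (+∞-identityˡ x)

+∞-zeroʳ : ∀ x → x +∞ ∞ ≡ ∞
+∞-zeroʳ (fin _) = refl
+∞-zeroʳ ∞       = refl

NonNeg : ℚ∞ → Set
NonNeg x = fin 0ℚ ≤∞ x

NonNeg-+ : ∀ {x y} → NonNeg x → NonNeg y → NonNeg (x +∞ y)
NonNeg-+ {x} {y} p q = subst (_≤∞ x +∞ y) (+∞-identityˡ _) (+∞-mono p q)

x≤y+x : ∀ x {y} → NonNeg y → x ≤∞ y +∞ x
x≤y+x x {y} p = subst (_≤∞ y +∞ x) (+∞-identityˡ x) (+∞-mono p ≤∞-refl)

x≤x+y : ∀ x {y} → NonNeg y → x ≤∞ x +∞ y
x≤x+y x {y} p = subst (x ≤∞_) (+∞-comm y x) (x≤y+x x p)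

⊓∞-sel : ∀ x y → (x ⊓∞ y ≡ x) ⊎ (x ⊓∞ y ≡ y)
⊓∞-sel (fin p) (fin q) with ℚ.⊓-sel p q
... | inj₁ e = inj₁ (cong fin e)
... | inj₂ e = inj₂ (cong fin e)
⊓∞-sel (fin _) ∞ = inj₁ refl
⊓∞-sel ∞       _ = inj₂ refl

⊓∞≤ˡ : ∀ x y → x ⊓∞ y ≤∞ x
⊓∞≤ˡ (fin p) (fin q) = fin≤ (ℚ.p⊓q≤p p q)
⊓∞≤ˡ (fin _) ∞       = ≤∞-refl
⊓∞≤ˡ ∞       y       = y ≤∞∞

⊓∞≤ʳ : ∀ x y → x ⊓∞ y ≤∞ y
⊓∞≤ʳ (fin p) (fin q) = fin≤ (ℚ.p⊓q≤q p q)
⊓∞≤ʳ (fin _) ∞       = _ ≤∞∞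
⊓∞≤ʳ ∞       _       = ≤∞-refl

⊓∞-glb : ∀ {x y z} → z ≤∞ x → z ≤∞ y → z ≤∞ x ⊓∞ y
⊓∞-glb {fin _} {fin _} (fin≤ p) (fin≤ q) = fin≤ (ℚ.⊓-glb p q)
⊓∞-glb {fin _} {∞}     p        _        = p
⊓∞-glb {∞}             _        q        = q

⊔∞-≥ˡ : ∀ x y → x ≤∞ x ⊔∞ y
⊔∞-≥ˡ (fin p) (fin q) = fin≤ (ℚ.p≤p⊔q p q)
⊔∞-≥ˡ (fin _) ∞       = _ ≤∞∞
⊔∞-≥ˡ ∞       _       = _ ≤∞∞

⊔∞-≥ʳ : ∀ x y → y ≤∞ x ⊔∞ y
⊔∞-≥ʳ (fin p) (fin q) = fin≤ (ℚ.p≤q⊔p p q)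
⊔∞-≥ʳ (fin _) ∞       = _ ≤∞∞
⊔∞-≥ʳ ∞       _       = _ ≤∞∞

⊔∞-lub : ∀ {x y z} → x ≤∞ z → y ≤∞ z → x ⊔∞ y ≤∞ z
⊔∞-lub (fin≤ p) (fin≤ q) = fin≤ (ℚ.⊔-lub p q)
⊔∞-lub (_ ≤∞∞)  _        = _ ≤∞∞

0·∞ : ∀ x → 0ℚ ·∞ x ≡ fin 0ℚ
0·∞ (fin p) = cong fin (ℚ.*-zeroˡ p)
0·∞ ∞ with 0ℚ ℚ.≟ 0ℚ
... | yes _ = refl
... | no 0≢0 = ⊥-elim (0≢0 refl)

NonNeg-· : ∀ {q x} → 0ℚ ≤ q → NonNeg x → NonNeg (q ·∞ x)
NonNeg-· {q} {fin p} 0≤q (fin≤ 0≤p) =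
  fin≤ (ℚ.nonNegative⁻¹ _ {{ℚ.nonNeg*nonNeg⇒nonNeg q {{nonNegative 0≤q}} p {{nonNegative 0≤p}}}})
NonNeg-· {q} {∞} _ _ with q ℚ.≟ 0ℚ
... | yes _ = ≤∞-refl
... | no _  = _ ≤∞∞

·∞-monoʳ : ∀ {q x y} → 0ℚ ≤ q → x ≤∞ y → q ·∞ x ≤∞ q ·∞ y
·∞-monoʳ {q} 0≤q (fin≤ p≤p′) = fin≤ (ℚ.*-monoˡ-≤-nonNeg q {{nonNegative 0≤q}} p≤p′)
·∞-monoʳ {q} {x} _ (_ ≤∞∞) with q ℚ.≟ 0ℚ
·∞-monoʳ {x = fin p} _ (_ ≤∞∞) | yes refl = ≤∞-reflexive (0·∞ (fin p))
·∞-monoʳ {x = ∞}     _ (_ ≤∞∞) | yes refl = ≤∞-refl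
... | no _ = _ ≤∞∞

·∞-distribˡ-+∞ : ∀ q x y → q ·∞ (x +∞ y) ≡ q ·∞ x +∞ q ·∞ y
·∞-distribˡ-+∞ q (fin p) (fin p′) = cong fin (ℚ.*-distribˡ-+ q p p′)
·∞-distribˡ-+∞ q (fin p) ∞ with q ℚ.≟ 0ℚ
... | yes refl = cong fin (sym (trans (ℚ.+-identityʳ _) (ℚ.*-zeroˡ p)))
... | no _     = refl
·∞-distribˡ-+∞ q ∞ y with q ℚ.≟ 0ℚ
... | yes refl = sym (trans (cong (fin 0ℚ +∞_) (0·∞ y)) (+∞-identityʳ (fin 0ℚ)))
... | no _     = refl

·∞-distribʳ-+ : ∀ p q x → 0ℚ ≤ p → 0ℚ ≤ q → NonNeg x →
                (p + q) ·∞ x ≤∞ p ·∞ x +∞ q ·∞ x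
·∞-distribʳ-+ p q (fin r) _ _ _ = fin≤ (ℚ.≤-reflexive (ℚ.*-distribʳ-+ r p q))
·∞-distribʳ-+ p q ∞ 0≤p 0≤q _ with (p + q) ℚ.≟ 0ℚ
... | yes _ = NonNeg-+ (NonNeg-· {p} {∞} 0≤p (_ ≤∞∞)) (NonNeg-· {q} {∞} 0≤q (_ ≤∞∞))
... | no p+q≢0 with p ℚ.≟ 0ℚ | q ℚ.≟ 0ℚ
...   | yes refl | yes refl = ⊥-elim (p+q≢0 refl)
...   | yes _    | no _     = _ ≤∞∞
...   | no _     | _        = _ ≤∞∞

-- Every predicate is preserved by binary minima, since ⊓∞ selects an
-- argument; hence by minima over Fin m when it also holds for ∞ (= min ∅).
⊓∞-preserves : ∀ (P : ℚ∞ → Set) {x y} → P x → P y → P (x ⊓∞ y)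
⊓∞-preserves P {x} {y} px py with ⊓∞-sel x y
... | inj₁ e = subst P (sym e) px
... | inj₂ e = subst P (sym e) py

minFin-preserves : ∀ {m} (P : ℚ∞ → Set) {g : Fin m → ℚ∞} →
                   P ∞ → (∀ i → P (g i)) → P (minFin g)
minFin-preserves {zero}  P p∞ pg = p∞
minFin-preserves {suc m} P p∞ pg =
  ⊓∞-preserves P (pg zero) (minFin-preserves P p∞ (λ i → pg (suc i)))

minFin≤ : ∀ {m} (g : Fin m → ℚ∞) i → minFin g ≤∞ g i
minFin≤ g zero    = ⊓∞≤ˡ _ _
minFin≤ g (suc i) = ≤∞-trans (⊓∞≤ʳ _ _) (minFin≤ (λ j → g (suc j)) i)

minFin-mono : ∀ {m} {g h : Fin m → ℚ∞} → (∀ i → g i ≤∞ h i) → minFin g ≤∞ minFin h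
minFin-mono {zero}  g≤h = ≤∞-refl
minFin-mono {suc m} g≤h =
  ⊓∞-glb (≤∞-trans (⊓∞≤ˡ _ _) (g≤h zero))
         (≤∞-trans (⊓∞≤ʳ _ _) (minFin-mono (λ i → g≤h (suc i))))

maxFin≥ : ∀ {m} (g : Fin m → ℚ∞) i → g i ≤∞ maxFin g
maxFin≥ g zero    = ⊔∞-≥ˡ _ _
maxFin≥ g (suc i) = ≤∞-trans (maxFin≥ (λ j → g (suc j)) i) (⊔∞-≥ʳ _ _)

-- The empty maximum is 0, so the upper bound must be non-negative.
maxFin-lub : ∀ {m} {g : Fin m → ℚ∞} {b} → NonNeg b → (∀ i → g i ≤∞ b) → maxFin g ≤∞ b
maxFin-lub {zero}  0≤b g≤b = 0≤b
maxFin-lub {suc m} 0≤b g≤b = ⊔∞-lub (g≤b zero) (maxFin-lub 0≤b (λ i → g≤b (suc i)))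

sumFin-mono : ∀ {m} {g h : Fin m → ℚ∞} → (∀ i → g i ≤∞ h i) → sumFin g ≤∞ sumFin h
sumFin-mono {zero}  g≤h = ≤∞-refl
sumFin-mono {suc m} g≤h = +∞-mono (g≤h zero) (sumFin-mono (λ i → g≤h (suc i)))

NonNeg-sumFin : ∀ {m} {g : Fin m → ℚ∞} → (∀ i → NonNeg (g i)) → NonNeg (sumFin g)
NonNeg-sumFin {zero}  0≤g = ≤∞-refl
NonNeg-sumFin {suc m} 0≤g = NonNeg-+ (0≤g zero) (NonNeg-sumFin (λ i → 0≤g (suc i)))

+∞-interchange : ∀ a b c d → (a +∞ b) +∞ (c +∞ d) ≡ (a +∞ c) +∞ (b +∞ d)
+∞-interchange a b c d = begin
  (a +∞ b) +∞ (c +∞ d)  ≡⟨ +∞-assoc a b (c +∞ d) ⟩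
  a +∞ (b +∞ (c +∞ d))  ≡⟨ cong (a +∞_) (sym (+∞-assoc b c d)) ⟩
  a +∞ ((b +∞ c) +∞ d)  ≡⟨ cong (λ t → a +∞ (t +∞ d)) (+∞-comm b c) ⟩
  a +∞ ((c +∞ b) +∞ d)  ≡⟨ cong (a +∞_) (+∞-assoc c b d) ⟩
  a +∞ (c +∞ (b +∞ d))  ≡⟨ sym (+∞-assoc a c (b +∞ d)) ⟩
  (a +∞ c) +∞ (b +∞ d)  ∎
  where open ≡-Reasoning

sumFin-+∞ : ∀ {m} (g h : Fin m → ℚ∞) → sumFin (λ i → g i +∞ h i) ≡ sumFin g +∞ sumFin h
sumFin-+∞ {zero}  g h = refl
sumFin-+∞ {suc m} g h =
  trans (cong ((g zero +∞ h zero) +∞_) (sumFin-+∞ (λ i → g (suc i)) (λ i → h (suc i))))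
        (+∞-interchange _ _ _ _)

NonNeg-sumℚ : ∀ {m} (h : Fin m → ℚ) → (∀ i → 0ℚ ≤ h i) → 0ℚ ≤ sumℚ h
NonNeg-sumℚ {zero}  h 0≤h = ℚ.≤-refl
NonNeg-sumℚ {suc m} h 0≤h =
  ℚ.+-mono-≤ (0≤h zero) (NonNeg-sumℚ (λ i → h (suc i)) (λ i → 0≤h (suc i)))

sumℚ-·∞ : ∀ {m} (h : Fin m → ℚ) x → (∀ i → 0ℚ ≤ h i) → NonNeg x →
          sumℚ h ·∞ x ≤∞ sumFin (λ i → h i ·∞ x)
sumℚ-·∞ {zero}  h x 0≤h 0≤x = ≤∞-reflexive (0·∞ x)
sumℚ-·∞ {suc m} h x 0≤h 0≤x =
  ≤∞-trans (·∞-distribʳ-+ (h zero) _ x (0≤h zero) (NonNeg-sumℚ _ (λ i → 0≤h (suc i))) 0≤x)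
           (+∞-mono ≤∞-refl (sumℚ-·∞ (λ i → h (suc i)) x (λ i → 0≤h (suc i)) 0≤x))

if-true : ∀ {A : Set} {b : Bool} {x y : A} → b ≡ true → (if b then x else y) ≡ x
if-true refl = refl

∈⇒lookup : ∀ {m} {R : Subset m} {r} → r ∈ R → lookup R r ≡ true
∈⇒lookup = []=⇒lookup

minIn≤ : ∀ {m} {R : Subset m} (g : Fin m → ℚ∞) {r} → r ∈ R → minIn R g ≤∞ g r
minIn≤ g {r} r∈R = ≤∞-trans (minFin≤ _ r) (≤∞-reflexive (if-true (∈⇒lookup r∈R)))

minIn-antitone : ∀ {m} {R S : Subset m} (g : Fin m → ℚ∞) → R ⊆ S → minIn S g ≤∞ minIn R g
minIn-antitone {R = R} {S} g R⊆S = minFin-mono pointwise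
  where
  pointwise : ∀ i → (if lookup S i then g i else ∞) ≤∞ (if lookup R i then g i else ∞)
  pointwise i with lookup R i in i∈R
  ... | true  = ≤∞-reflexive (if-true (∈⇒lookup (R⊆S (lookup⇒[]= i R i∈R))))
  ... | false = _ ≤∞∞

maxIn≥ : ∀ {m} {R : Subset m} (g : Fin m → ℚ∞) {r} → r ∈ R → g r ≤∞ maxIn R g
maxIn≥ g {r} r∈R = ≤∞-trans (≤∞-reflexive (sym (if-true (∈⇒lookup r∈R)))) (maxFin≥ _ r)

maxIn-lub : ∀ {m} {R : Subset m} {g : Fin m → ℚ∞} {b} →
            NonNeg b → (∀ r → r ∈ R → g r ≤∞ b) → maxIn R g ≤∞ b
maxIn-lub {R = R} {g} {b} 0≤b g≤b = maxFin-lub 0≤b pointwise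
  where
  pointwise : ∀ r → (if lookup R r then g r else fin 0ℚ) ≤∞ b
  pointwise r with lookup R r in r∈R
  ... | true  = g≤b r (lookup⇒[]= r R r∈R)
  ... | false = 0≤b

NonNeg-sumIn : ∀ {m} (R : Subset m) {g : Fin m → ℚ∞} → (∀ i → NonNeg (g i)) → NonNeg (sumIn R g)
NonNeg-sumIn R {g} 0≤g = NonNeg-sumFin pointwise
  where
  pointwise : ∀ i → NonNeg (if lookup R i then g i else fin 0ℚ)
  pointwise i with lookup R i
  ... | true  = 0≤g i
  ... | false = ≤∞-refl

x∈p─q⇒x∉q : ∀ {m} {p q : Subset m} {x} → x ∈ p ─ q → x ∉ q
x∈p─q⇒x∉q {p = _ ∷ p} {false ∷ q} (there x∈) (there x∈q) = x∈p─q⇒x∉q x∈ x∈q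
x∈p─q⇒x∉q {p = _ ∷ p} {true  ∷ q} (there x∈) (there x∈q) = x∈p─q⇒x∉q x∈ x∈q

─-monoˡ : ∀ {m} {p p′ q : Subset m} → p ⊆ p′ → p ─ q ⊆ p′ ─ q
─-monoˡ {p = p} {q = q} p⊆p′ x∈ = x∈p∧x∉q⇒x∈p─q (p⊆p′ (p─q⊆p p q x∈)) (x∈p─q⇒x∉q x∈)

-- If r ∉ R, then R ∖ {r} = R contains R ∖ {r′} for every r′.
─-outside : ∀ {m} {R : Subset m} {r} r′ → r ∉ R → R ─ ⁅ r′ ⁆ ⊆ R ─ ⁅ r ⁆
─-outside {R = R} {r} r′ r∉R x∈ = x∈p∧x∉q⇒x∈p─q x∈R x∉⁅r⁆
  where
  x∈R = p─q⊆p R ⁅ r′ ⁆ x∈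
  x∉⁅r⁆ = λ x∈⁅r⁆ → r∉R (subst (_∈ R) (x∈⁅y⁆⇒x≡y r x∈⁅r⁆) x∈R)

nonempty-of-isEmpty : ∀ {m} (R : Subset m) → isEmpty R ≡ false → Nonempty R
nonempty-of-isEmpty (true  ∷ R) _ = zero , here
nonempty-of-isEmpty (false ∷ R) e with nonempty-of-isEmpty R e
... | r , r∈R = suc r , there r∈R

lookup-injective : ∀ {A : Set} {xs : List A} → Unique xs → Injective _≡_ _≡_ (List.lookup xs)
lookup-injective {xs = x ∷ xs} (x∉xs ∷ uniq) {zero}  {zero}  _ = refl
lookup-injective {xs = x ∷ xs} (x∉xs ∷ uniq) {zero}  {suc j} e = ⊥-elim (All.lookup x∉xs (∈-lookup j) e)
lookup-injective {xs = x ∷ xs} (x∉xs ∷ uniq) {suc i} {zero}  e = ⊥-elim (All.lookup x∉xs (∈-lookup i) (sym e))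
lookup-injective {xs = x ∷ xs} (x∉xs ∷ uniq) {suc i} {suc j} e = cong suc (lookup-injective uniq e)

unique-length : ∀ {m} {xs : List (Fin m)} → Unique xs → List.length xs ℕ.≤ m
unique-length uniq = injective⇒≤ (lookup-injective uniq)

-- Loop erasure shows that
-- walks of arbitrary length never beat dist = walkDist l n, which gives
-- the triangle inequality (concatenation) and symmetry (reversal).

module Metric {n : ℕ} (l : Lengths n) (l-nonneg : ∀ u v → NonNeg (l u v)) where

  -- A walk from u, extended edge by edge at its end, as in walkDist.
  data Walk (u : Fin n) : Fin n → Set where
    []  : Walk u u
    _▷_ : ∀ {w} → Walk u w → (v : Fin n) → Walk u v

  infixl 5 _▷_

  edges : ∀ {u v} → Walk u v → ℕ
  edges []      = 0
  edges (p ▷ _) = suc (edges p)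

  cost : ∀ {u v} → Walk u v → ℚ∞
  cost []              = fin 0ℚ
  cost (_▷_ {w} p v) = cost p +∞ l w v

  -- the vertices visited by a walk, last one first
  visits : ∀ {u v} → Walk u v → List (Fin n)
  visits {u} []  = u ∷ []
  visits (p ▷ v) = v ∷ visits p

  length-visits : ∀ {u v} (p : Walk u v) → List.length (visits p) ≡ suc (edges p)
  length-visits []      = refl
  length-visits (p ▷ _) = cong suc (length-visits p)

  NonNeg-cost : ∀ {u v} (p : Walk u v) → NonNeg (cost p)
  NonNeg-cost []              = ≤∞-refl
  NonNeg-cost (_▷_ {w} p v) = NonNeg-+ (NonNeg-cost p) (l-nonneg w v)

  self-distance : ∀ u → walkDist l 0 u u ≡ fin 0ℚ
  self-distance u with u ≟F u
  ... | yes _  = refl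
  ... | no u≢u = ⊥-elim (u≢u refl)

  walkDist≤cost : ∀ {k u v} (p : Walk u v) → edges p ℕ.≤ k → walkDist l k u v ≤∞ cost p
  walkDist≤cost {zero}  {u} []      _       = ≤∞-reflexive (self-distance u)
  walkDist≤cost {suc k}     []      _       = ≤∞-trans (⊓∞≤ˡ _ _) (walkDist≤cost {k} [] z≤n)
  walkDist≤cost {suc k} {u} (_▷_ {w} p v) (s≤s p≤k) =
    ≤∞-trans (⊓∞≤ʳ _ _)
      (≤∞-trans (minFin≤ (λ w′ → walkDist l k u w′ +∞ l w′ v) w)
                (+∞-mono (walkDist≤cost p p≤k) ≤∞-refl))

  Realised : Fin n → Fin n → ℚ∞ → Set
  Realised u v x = (x ≡ ∞) ⊎ Σ (Walk u v) (λ p → cost p ≡ x)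

  walkDist-realised : ∀ k u v → Realised u v (walkDist l k u v)
  walkDist-realised zero u v with u ≟F v
  ... | yes refl = inj₂ ([] , refl)
  ... | no _     = inj₁ refl
  walkDist-realised (suc k) u v =
    ⊓∞-preserves (Realised u v) (walkDist-realised k u v)
      (minFin-preserves (Realised u v) (inj₁ refl) extend)
    where
    extend : ∀ w → Realised u v (walkDist l k u w +∞ l w v)
    extend w with walkDist-realised k u w
    ... | inj₁ e       = inj₁ (cong (_+∞ l w v) e)
    ... | inj₂ (p , e) = inj₂ (p ▷ v , cong (_+∞ l w v) e)

  Simple : ∀ {u v} → Walk u v → Set
  Simple p = Unique (visits p)

  simple-edges : ∀ {u v} (p : Walk u v) → Simple p → edges p ℕ.≤ n
  simple-edges p simple =
    ℕ.≤-trans (ℕ.n≤1+n _) (subst (ℕ._≤ n) (length-visits p) (unique-length simple))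

  truncate : ∀ {u w v} (p : Walk u w) → v ∈ₗ visits p →
             Σ (Walk u v) λ q → (cost q ≤∞ cost p) × (Simple p → Simple q)
  truncate []      (here refl) = [] , ≤∞-refl , id
  truncate (p ▷ w) (here refl) = p ▷ w , ≤∞-refl , id
  truncate (_▷_ {w′} p w) (there v∈p) with truncate p v∈p
  ... | q , q≤p , keep = q , ≤∞-trans q≤p (x≤x+y _ (l-nonneg w′ w)) , λ { (_ ∷ s) → keep s }

  open DecMembership (_≟F_ {n}) using () renaming (_∈?_ to _∈ₗ?_)

  erase : ∀ {u v} (p : Walk u v) → Σ (Walk u v) λ q → Simple q × (cost q ≤∞ cost p)
  erase []              = [] , [] ∷ [] , ≤∞-refl
  erase (_▷_ {w} p v) with erase p
  ... | q , simple-q , q≤p with v ∈ₗ? visits q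
  ...   | yes v∈q = let q′ , q′≤q , keep = truncate q v∈q in
                    q′ , keep simple-q , ≤∞-trans q′≤q (≤∞-trans q≤p (x≤x+y _ (l-nonneg w v)))
  ...   | no v∉q  = q ▷ v , ¬Any⇒All¬ _ v∉q ∷ simple-q , +∞-mono q≤p ≤∞-refl

  dist≤cost : ∀ {u v} (p : Walk u v) → dist l u v ≤∞ cost p
  dist≤cost p with erase p
  ... | q , simple-q , q≤p = ≤∞-trans (walkDist≤cost q (simple-edges q simple-q)) q≤p

  infixr 5 _++ᵂ_
  _++ᵂ_ : ∀ {u v w} → Walk u v → Walk v w → Walk u w
  p ++ᵂ []      = p
  p ++ᵂ (q ▷ x) = (p ++ᵂ q) ▷ x

  cost-++ : ∀ {u v w} (p : Walk u v) (q : Walk v w) → cost (p ++ᵂ q) ≡ cost p +∞ cost q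
  cost-++ p []              = sym (+∞-identityʳ _)
  cost-++ p (_▷_ {w} q x) = trans (cong (_+∞ l w x) (cost-++ p q)) (+∞-assoc _ _ _)

  dist-triangle : ∀ u v w → dist l u w ≤∞ dist l u v +∞ dist l v w
  dist-triangle u v w with walkDist-realised n u v | walkDist-realised n v w
  ... | inj₁ e       | _            = subst (λ t → dist l u w ≤∞ t +∞ dist l v w) (sym e) (_ ≤∞∞)
  ... | inj₂ _       | inj₁ e       =
    subst (λ t → dist l u w ≤∞ dist l u v +∞ t) (sym e)
          (subst (dist l u w ≤∞_) (sym (+∞-zeroʳ (dist l u v))) (_ ≤∞∞))
  ... | inj₂ (p , ep) | inj₂ (q , eq) = begin
    dist l u w                ≤⟨ dist≤cost (p ++ᵂ q) ⟩
    cost (p ++ᵂ q)            ≡⟨ cost-++ p q ⟩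
    cost p +∞ cost q          ≡⟨ cong₂ _+∞_ ep eq ⟩
    dist l u v +∞ dist l v w  ∎
    where open ≤∞-Reasoning

  NonNeg-dist : ∀ u v → NonNeg (dist l u v)
  NonNeg-dist u v with walkDist-realised n u v
  ... | inj₁ e       = subst NonNeg (sym e) (_ ≤∞∞)
  ... | inj₂ (p , e) = subst NonNeg e (NonNeg-cost p)

  NonNeg-distSet : ∀ v R → NonNeg (distSet l v R)
  NonNeg-distSet v R = minFin-preserves NonNeg (_ ≤∞∞) pointwise
    where
    pointwise : ∀ r → NonNeg (if lookup R r then dist l v r else ∞)
    pointwise r with lookup R r
    ... | true  = NonNeg-dist v r
    ... | false = _ ≤∞∞

  distSet-triangle : ∀ u v Y → distSet l u Y ≤∞ dist l u v +∞ distSet l v Y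
  distSet-triangle u v Y =
    minFin-preserves (λ t → distSet l u Y ≤∞ dist l u v +∞ t) below-∞ via
    where
    below-∞ : distSet l u Y ≤∞ dist l u v +∞ ∞
    below-∞ = subst (distSet l u Y ≤∞_) (sym (+∞-zeroʳ _)) (_ ≤∞∞)
    via : ∀ i → distSet l u Y ≤∞ dist l u v +∞ (if lookup Y i then dist l v i else ∞)
    via i with lookup Y i in i∈Y
    ... | true  = ≤∞-trans (minIn≤ (dist l u) (lookup⇒[]= i Y i∈Y)) (dist-triangle u v i)
    ... | false = below-∞

  module Symmetric (l-sym : ∀ u v → l u v ≡ l v u) where

    reverse : ∀ {u v} → Walk u v → Walk v u
    reverse []              = []
    reverse (_▷_ {w} p v) = ([] ▷ w) ++ᵂ reverse p

    cost-reverse : ∀ {u v} (p : Walk u v) → cost (reverse p) ≡ cost p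
    cost-reverse []              = refl
    cost-reverse (_▷_ {w} p v) = begin
      cost (([] ▷ w) ++ᵂ reverse p)          ≡⟨ cost-++ ([] ▷ w) (reverse p) ⟩
      (fin 0ℚ +∞ l v w) +∞ cost (reverse p)  ≡⟨ cong₂ _+∞_ (trans (+∞-identityˡ _) (l-sym v w)) (cost-reverse p) ⟩
      l w v +∞ cost p                         ≡⟨ +∞-comm (l w v) (cost p) ⟩
      cost p +∞ l w v                         ∎
      where open ≡-Reasoning

    dist-sym : ∀ u v → dist l u v ≤∞ dist l v u
    dist-sym u v with walkDist-realised n v u
    ... | inj₁ e       = subst (dist l u v ≤∞_) (sym e) (_ ≤∞∞)
    ... | inj₂ (p , e) = begin
      dist l u v         ≤⟨ dist≤cost (reverse p) ⟩
      cost (reverse p)   ≡⟨ cost-reverse p ⟩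
      cost p             ≡⟨ e ⟩
      dist l v u         ∎
      where open ≤∞-Reasoning

    detour : ∀ {X Y : Subset n} r v → Y ⊆ X →
             distSet l r X ≤∞ distSet l v Y +∞ dist l v r
    detour {X} {Y} r v Y⊆X = begin
      distSet l r X                ≤⟨ minIn-antitone (dist l r) Y⊆X ⟩
      distSet l r Y                ≤⟨ distSet-triangle r v Y ⟩
      dist l r v +∞ distSet l v Y  ≤⟨ +∞-mono (dist-sym r v) ≤∞-refl ⟩
      dist l v r +∞ distSet l v Y  ≡⟨ +∞-comm (dist l v r) (distSet l v Y) ⟩
      distSet l v Y +∞ dist l v r  ∎
      where open ≤∞-Reasoning

minList≤ : ∀ {x xs} → x ∈ₗ xs → minList xs ≤∞ x
minList≤ (here refl) = ⊓∞≤ˡ _ _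
minList≤ {xs = y ∷ xs} (there x∈xs) = ≤∞-trans (⊓∞≤ʳ y (minList xs)) (minList≤ x∈xs)

minList-map-preserves : ∀ {A : Set} (P : ℚ∞ → Set) {F : A → ℚ∞} →
                        P ∞ → (∀ y → P (F y)) → ∀ ys → P (minList (List.map F ys))
minList-map-preserves P p∞ pF []       = p∞
minList-map-preserves P p∞ pF (y ∷ ys) = ⊓∞-preserves P (pF y) (minList-map-preserves P p∞ pF ys)

∈-allSubsets : ∀ {m} (R : Subset m) → R ∈ₗ allSubsets m
∈-allSubsets []          = here refl
∈-allSubsets {suc m} (true  ∷ R) = ∈-++⁺ˡ (∈-map⁺ (true ∷_) (∈-allSubsets R))
∈-allSubsets {suc m} (false ∷ R) =
  ∈-++⁺ʳ (List.map (true ∷_) (allSubsets m)) (∈-map⁺ (false ∷_) (∈-allSubsets R))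

lengths-nonneg : ∀ {n} {l : Lengths n} → ValidLengths l → ∀ u v → NonNeg (l u v)
lengths-nonneg {l = l} (_ , positive) u v with l u v in e
... | fin x = fin≤ (ℚ.<⇒≤ (positive u v x e))
... | ∞     = _ ≤∞∞

module CandidateBound
  {n : ℕ} (l : Lengths n) (f ω : Fin n → ℚ) (valid : ValidLengths l)
  (f-nonneg : ∀ v → 0ℚ ≤ f v) (ω-nonneg : ∀ v → 0ℚ ≤ ω v)
  (R₁ : Subset n) (a : Fin n → Fin n) (assigned : IsAssignment l R₁ a)
  (R : Subset n) (R-nonempty : Nonempty R) where

  open Metric l (lengths-nonneg valid)
  open Symmetric (proj₁ valid)

  failure : Fin n → ℚ∞
  failure r = sumFin (λ v → ω v ·∞ distSet l v (R ─ ⁅ r ⁆))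

  worstFailure : ℚ∞
  worstFailure = maxIn R failure

  NonNeg-failure : ∀ r → NonNeg (failure r)
  NonNeg-failure r = NonNeg-sumFin (λ v → NonNeg-· (ω-nonneg v) (NonNeg-distSet v (R ─ ⁅ r ⁆)))

  NonNeg-Cship : NonNeg (Cship l ω R₁)
  NonNeg-Cship = NonNeg-sumFin (λ v → NonNeg-· (ω-nonneg v) (NonNeg-distSet v R₁))

  NonNeg-worstFailure : NonNeg worstFailure
  NonNeg-worstFailure =
    ≤∞-trans (NonNeg-failure (proj₁ R-nonempty)) (maxIn≥ failure (proj₂ R-nonempty))

  failure≤worst : ∀ r → failure r ≤∞ worstFailure
  failure≤worst r with r ∈? R
  ... | yes r∈R = maxIn≥ failure r∈R
  ... | no  r∉R = let r′ , r′∈R = R-nonempty in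
    ≤∞-trans (sumFin-mono (λ v → ·∞-monoʳ (ω-nonneg v)
                                   (minIn-antitone (dist l v) (─-outside r′ r∉R))))
             (maxIn≥ failure r′∈R)

  backupSet : Fin n → Subset n
  backupSet r = (R₁ ∪ R) ─ ⁅ r ⁆

  client-detour : ∀ r v → r ∈ R₁ → a v ≡ r →
    distSet l r (backupSet r) ≤∞ distSet l v (R ─ ⁅ r ⁆) +∞ distSet l v R₁
  client-detour r v r∈R₁ refl =
    subst (λ t → distSet l r (backupSet r) ≤∞ distSet l v (R ─ ⁅ r ⁆) +∞ t)
          (proj₂ (assigned v (r , r∈R₁)))
          (detour {backupSet r} {R ─ ⁅ r ⁆} r v (─-monoˡ (q⊆p∪q R₁ R)))

  backup-at : ∀ r → r ∈ R₁ →
    ω′ ω R₁ a r ·∞ distSet l r (backupSet r) ≤∞ failure r +∞ Cship l ω R₁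
  backup-at r r∈R₁ = begin
    ω′ ω R₁ a r ·∞ D                         ≡⟨ cong (_·∞ D) (if-true (∈⇒lookup r∈R₁)) ⟩
    sumℚ share ·∞ D                          ≤⟨ sumℚ-·∞ share D share-nonneg (NonNeg-distSet r (backupSet r)) ⟩
    sumFin (λ v → share v ·∞ D)              ≤⟨ sumFin-mono per-client ⟩
    sumFin (λ v → ω v ·∞ distSet l v (R ─ ⁅ r ⁆) +∞ ω v ·∞ distSet l v R₁)
                                             ≡⟨ sumFin-+∞ (λ v → ω v ·∞ distSet l v (R ─ ⁅ r ⁆)) (λ v → ω v ·∞ distSet l v R₁) ⟩
    failure r +∞ Cship l ω R₁                ∎
    where
    open ≤∞-Reasoning
    D = distSet l r (backupSet r)

    share : Fin n → ℚ
    share v = if does (a v ≟F r) then ω v else 0ℚ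

    share-nonneg : ∀ v → 0ℚ ≤ share v
    share-nonneg v with does (a v ≟F r)
    ... | true  = ω-nonneg v
    ... | false = ℚ.≤-refl

    per-client : ∀ v → share v ·∞ D ≤∞ ω v ·∞ distSet l v (R ─ ⁅ r ⁆) +∞ ω v ·∞ distSet l v R₁
    per-client v with a v ≟F r
    ... | yes av≡r = ≤∞-trans (·∞-monoʳ (ω-nonneg v) (client-detour r v r∈R₁ av≡r))
                              (≤∞-reflexive (·∞-distribˡ-+∞ (ω v) (distSet l v (R ─ ⁅ r ⁆)) (distSet l v R₁)))
    ... | no _     = ≤∞-trans (≤∞-reflexive (0·∞ D))
                              (NonNeg-+ (NonNeg-· (ω-nonneg v) (NonNeg-distSet v (R ─ ⁅ r ⁆)))
                                        (NonNeg-· (ω-nonneg v) (NonNeg-distSet v R₁)))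

  backup-cost : Cbu l (ω′ ω R₁ a) R₁ R ≤∞ worstFailure +∞ Cship l ω R₁
  backup-cost = maxIn-lub (NonNeg-+ NonNeg-worstFailure NonNeg-Cship) λ r r∈R₁ →
    ≤∞-trans (backup-at r r∈R₁) (+∞-mono (failure≤worst r) ≤∞-refl)

  facility-cost : Cfacil (f′ f R₁) R ≤∞ Cfacil f R
  facility-cost = sumFin-mono pointwise
    where
    f′≤f : ∀ v → f′ f R₁ v ≤ f v
    f′≤f v with lookup R₁ v
    ... | true  = f-nonneg v
    ... | false = ℚ.≤-refl
    pointwise : ∀ v → (if lookup R v then fin (f′ f R₁ v) else fin 0ℚ)
                      ≤∞ (if lookup R v then fin (f v) else fin 0ℚ)
    pointwise v with lookup R v
    ... | true  = fin≤ (f′≤f v)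
    ... | false = ≤∞-refl

  NonNeg-Cfacil : NonNeg (Cfacil f R₁)
  NonNeg-Cfacil = NonNeg-sumIn R₁ (λ v → fin≤ (f-nonneg v))

  candidate-bound : Cconcbu l (f′ f R₁) (ω′ ω R₁ a) R₁ R ≤∞ CRFTFL l f ω R +∞ CUFL l f ω R₁
  candidate-bound = begin
    Cfacil (f′ f R₁) R +∞ Cbu l (ω′ ω R₁ a) R₁ R
      ≤⟨ +∞-mono facility-cost backup-cost ⟩
    Cfacil f R +∞ (worstFailure +∞ Cship l ω R₁)
      ≡⟨ sym (+∞-assoc (Cfacil f R) worstFailure (Cship l ω R₁)) ⟩
    CRFTFL l f ω R +∞ Cship l ω R₁
      ≤⟨ +∞-mono ≤∞-refl (x≤y+x (Cship l ω R₁) NonNeg-Cfacil) ⟩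
    CRFTFL l f ω R +∞ CUFL l f ω R₁
      ∎
    where open ≤∞-Reasoning

lemma2p5 : (n : ℕ) (l : Lengths n) (f ω : Fin n → ℚ) →
    ValidLengths l → (∀ v → 0ℚ ≤ f v) → (∀ v → 0ℚ ≤ ω v) →
    (R₁ : Subset n) (a : Fin n → Fin n) → IsAssignment l R₁ a →
    Cconcbu* l (f′ f R₁) (ω′ ω R₁ a) R₁ ≤∞ CRFTFL* l f ω +∞ CUFL l f ω R₁
lemma2p5 n l f ω valid f-nonneg ω-nonneg R₁ a assigned =
  minList-map-preserves (λ t → optimum ≤∞ t +∞ CUFL l f ω R₁) (_ ≤∞∞) per-candidate (allSubsets n)
  where
  optimum = Cconcbu* l (f′ f R₁) (ω′ ω R₁ a) R₁

  -- Compare with R₂ = R for every non-empty R; an empty R contributes ∞.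
  per-candidate : ∀ R → optimum ≤∞ (if isEmpty R then ∞ else CRFTFL l f ω R) +∞ CUFL l f ω R₁
  per-candidate R with isEmpty R in empty?
  ... | true  = _ ≤∞∞
  ... | false =
    ≤∞-trans (minList≤ (∈-map⁺ (Cconcbu l (f′ f R₁) (ω′ ω R₁ a) R₁) (∈-allSubsets R)))
             (CandidateBound.candidate-bound l f ω valid f-nonneg ω-nonneg R₁ a assigned
                R (nonempty-of-isEmpty R empty?))
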